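{- Let $\gamma_1,\gamma_2$ be positive roots of the root system of $\mathrm{Sp}_{2n}$ with $\gamma_1\ne\gamma_2$, $\tfrac12\mathrm{ht}(\gamma_2)<\mathrm{ht}(\gamma_1)\le\mathrm{ht}(\gamma_2)$ and $\langle\gamma_2,\gamma_1^\vee\rangle=2$. Then there exist integers $i,j$ with $1\le i<j\le n$ such that $\gamma_2=2\alpha_i+2\alpha_{i+1}+\dots+2\alpha_{n-1}+\beta$ and $\gamma_1=\alpha_i+\alpha_{i+1}+\dots+\alpha_{j-1}+2\alpha_j+2\alpha_{j+1}+\dots+2\alpha_{n-1}+\beta$.
   Context: $n>1$. The roots are those of $\mathrm{Sp}_{2n}$ with respect to the diagonal torus $t=\mathrm{diag}(a_1,\dots,a_n,a_n^{ -1},\dots,a_1^{ -1})$ and the upper triangular Borel subgroup (for the form $\begin{pmatrix}0&J_n\\-J_n&0\end{pmatrix}$); the simple roots are $\alpha_i(t)=a_i/a_{i+1}$ ($1\le i\le n-1$) and $\beta(t)=a_n^2$. $\mathrm{ht}$ is the height (sum of coefficients in terms of simple roots), $\gamma^\vee$ the coroot, and $\langle\cdot,\cdot\rangle$ the root–coroot pairing. -}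

module Defs where

open import Data.Nat as ℕ using (ℕ; zero; suc; _∸_)
open import Data.Fin using (Fin; toℕ; zero; suc)
open import Data.Integer using (ℤ; +_; _+_; _*_; -_; 0ℤ; 1ℤ)
open import Data.Vec using (Vec; tabulate; lookup)
open import Data.Bool using (Bool; if_then_else_)
open import Relation.Nullary.Decidable using (⌊_⌋)
open import Relation.Binary.PropositionalEquality using (_≡_)

-- Indices are 0-based: Fin n = {0,…,n-1} corresponds to {1,…,n} of the paper.

sumFin : ∀ {n} → (Fin n → ℤ) → ℤ
sumFin {zero}  f = 0ℤ
sumFin {suc n} f = f zero + sumFin (λ k → f (suc k))

-- Characters of the diagonal torus t = diag(a_1,…,a_n,a_n^{-1},…,a_1^{-1}):
-- x ∈ ℤ^n stands for t ↦ a_1^{x_1} ⋯ a_n^{x_n}.  Cocharacters likewise.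
Char : ℕ → Set
Char n = Vec ℤ n

e : ∀ {n} → Fin n → Char n
e i = tabulate λ k → if ⌊ toℕ k ℕ.≟ toℕ i ⌋ then 1ℤ else 0ℤ

_⊕_ : ∀ {n} → Char n → Char n → Char n
x ⊕ y = tabulate λ k → lookup x k + lookup y k

_⊖_ : ∀ {n} → Char n → Char n → Char n
x ⊖ y = tabulate λ k → lookup x k + (- lookup y k)

⟪_,_⟫ : ∀ {n} → Char n → Char n → ℤ
⟪ x , y ⟫ = sumFin λ k → lookup x k * lookup y k

-- Simple roots, indexed by Fin n: index k < n-1 is α_{k+1}(t) = a_{k+1}/a_{k+2}
-- (i.e. e_k - e_{k+1}); index n-1 is β(t) = a_n^2 (i.e. 2 e_{n-1}).
simple : ∀ {n} → Fin n → Char n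
simple {n} k = tabulate λ j →
  if ⌊ toℕ k ℕ.≟ (n ∸ 1) ⌋
  then (if ⌊ toℕ j ℕ.≟ toℕ k ⌋ then + 2 else 0ℤ)
  else (if ⌊ toℕ j ℕ.≟ toℕ k ⌋ then 1ℤ
        else if ⌊ toℕ j ℕ.≟ suc (toℕ k) ⌋ then - 1ℤ else 0ℤ)

lincomb : ∀ {n} → (Fin n → ℤ) → Char n
lincomb c = tabulate λ j → sumFin λ k → c k * lookup (simple k) j

-- Positive roots of Sp_{2n} w.r.t. the diagonal torus and the upper
-- triangular Borel:  e_i - e_j, e_i + e_j (i < j), and 2 e_i.
data PosRoot (n : ℕ) : Set where
  diff : (i j : Fin n) → toℕ i ℕ.< toℕ j → PosRoot n
  sum  : (i j : Fin n) → toℕ i ℕ.< toℕ j → PosRoot n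
  long : (i : Fin n) → PosRoot n

root : ∀ {n} → PosRoot n → Char n
root (diff i j _) = e i ⊖ e j
root (sum i j _)  = e i ⊕ e j
root (long i)     = e i ⊕ e i

coroot : ∀ {n} → PosRoot n → Char n
coroot (diff i j _) = e i ⊖ e j
coroot (sum i j _)  = e i ⊕ e j
coroot (long i)     = e i

pairing : ∀ {n} → PosRoot n → PosRoot n → ℤ
pairing γ δ = ⟪ root γ , coroot δ ⟫

IsCoeffs : ∀ {n} → Char n → (Fin n → ℤ) → Set
IsCoeffs x c = lincomb c ≡ x

ht : ∀ {n} → (Fin n → ℤ) → ℤ
ht c = sumFin c

-- coefficients of 2α_i + … + 2α_{n-1} + β  (paper's 1-based i = toℕ i + 1)
coeffs₂ : ∀ {n} → Fin n → Fin n → ℤ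
coeffs₂ {n} i k =
  if ⌊ toℕ k ℕ.≟ (n ∸ 1) ⌋ then 1ℤ
  else if ⌊ toℕ i ℕ.≤? toℕ k ⌋ then + 2 else 0ℤ

-- coefficients of α_i + … + α_{j-1} + 2α_j + … + 2α_{n-1} + β
coeffs₁ : ∀ {n} → Fin n → Fin n → Fin n → ℤ
coeffs₁ {n} i j k =
  if ⌊ toℕ k ℕ.≟ (n ∸ 1) ⌋ then 1ℤ
  else if ⌊ toℕ j ℕ.≤? toℕ k ⌋ then + 2
  else if ⌊ toℕ i ℕ.≤? toℕ k ⌋ then 1ℤ else 0ℤ

module Submission where

-- In coordinates ⟨γ₂, γ₁^∨⟩ is a signed count of index coincidences;
--     the value 2 with γ₁ ≠ γ₂ occurs only for γ₂ = 2e_a and γ₁ = e_a - e_b,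
--     e_a + e_b or e_b + e_a with a < b (classify).
-- (2) Heights.  The cocharacter 2ρ^∨ = (2n-1, 2n-3, …, 1) takes the value 2 on every
--     simple root, so pairing with it gives twice the height (height-root).  Hence
--     ht(2e_a) ≥ 2 ht(e_a - e_b) and ht(e_a + e_b) > ht(2e_b), excluding two cases.
-- (3) Coefficients.  The j-th coordinate of Σ_k A_k α_k is A_j · lead_j - A_{j-1};
--     writing the candidate coefficients as sums of step functions θ shows that
--     pairCoeffs a b expands e_a + e_b, and coeffs₁ i j, coeffs₂ i are instances.

open import Defs
open import Data.Nat as ℕ using (ℕ; zero; suc; _∸_; _≡ᵇ_; _≤ᵇ_; z≤n; s≤s)
import Data.Nat.Properties as ℕP
open import Data.Fin using (Fin; toℕ; zero; suc)
open import Data.Fin.Properties using (toℕ<n; toℕ-injective)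
open import Data.Integer using (ℤ; +_; _+_; _*_; -_; 0ℤ; 1ℤ; _<_; _≤_; +≤+; +<+)
import Data.Integer.Properties as ℤP
open import Data.Integer.Tactic.RingSolver using (solve-∀)
open import Algebra.Properties.Semiring.Sum ℤP.+-*-semiring
  using (sum-syntax; sum-cong-≗; sum-replicate-zero; ∑-distrib-+; ∑-comm; *-distribˡ-sum; *-distribʳ-sum)
  renaming (sum to ∑)
open import Data.Vec using (tabulate; lookup)
open import Data.Vec.Properties using (lookup∘tabulate; tabulate-cong)
open import Data.Bool using (true; false; if_then_else_; T)
open import Data.Unit using (tt)
open import Data.Product using (_×_; ∃₂; _,_)
open import Data.Sum using (_⊎_; inj₁; inj₂)
open import Data.Empty using (⊥-elim)
open import Relation.Nullary using (¬_; Dec; yes; no)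
open import Relation.Nullary.Decidable using (⌊_⌋; isYes≗does; dec-true; dec-false)
open import Relation.Binary.PropositionalEquality
  using (_≡_; _≢_; refl; sym; trans; cong; cong₂; subst; subst₂; module ≡-Reasoning)

≡ᵇ-true : ∀ {m n} → m ≡ n → (m ≡ᵇ n) ≡ true
≡ᵇ-true {m} {n} = dec-true (m ℕ.≟ n)

≡ᵇ-false : ∀ {m n} → m ≢ n → (m ≡ᵇ n) ≡ false
≡ᵇ-false {m} {n} = dec-false (m ℕ.≟ n)

≡ᵇ-sound : ∀ m n → (m ≡ᵇ n) ≡ true → m ≡ n
≡ᵇ-sound m n eq = ℕP.≡ᵇ⇒≡ m n (subst T (sym eq) tt)

≤ᵇ-true : ∀ {m n} → m ℕ.≤ n → (m ≤ᵇ n) ≡ true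
≤ᵇ-true {m} {n} = dec-true (m ℕ.≤? n)

≤ᵇ-sound : ∀ {m n} → (m ≤ᵇ n) ≡ true → m ℕ.≤ n
≤ᵇ-sound {m} {n} eq = ℕP.≤ᵇ⇒≤ m n (subst T (sym eq) tt)

δ : ℕ → ℕ → ℤ
δ m c = if m ≡ᵇ c then 1ℤ else 0ℤ

θ : ℕ → ℕ → ℤ
θ c m = if c ≤ᵇ m then 1ℤ else 0ℤ

δ-sym : ∀ m c → δ m c ≡ δ c m
δ-sym zero    zero    = refl
δ-sym zero    (suc c) = refl
δ-sym (suc m) zero    = refl
δ-sym (suc m) (suc c) = δ-sym m c

prev : (ℕ → ℤ) → ℕ → ℤ
prev f zero    = 0ℤ
prev f (suc m) = f m

θ-jump : ∀ c m → θ c (suc m) + - θ c m ≡ δ (suc m) c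
θ-jump zero          m       = refl
θ-jump (suc zero)    zero    = refl
θ-jump (suc (suc c)) zero    = refl
θ-jump (suc zero)    (suc m) = refl
θ-jump (suc (suc c)) (suc m) = θ-jump (suc c) m

θ-derivative : ∀ c m → θ c m + - prev (θ c) m ≡ δ m c
θ-derivative zero    zero    = refl
θ-derivative (suc c) zero    = refl
θ-derivative c       (suc m) = θ-jump c m

-- Finite sums.  Defs sums over Fin n by its own recursion; sumFin≡∑ transfers
-- such sums to the library's semiring summation, whose algebra of sums is reused.

sumFin≡∑ : ∀ {n} (f : Fin n → ℤ) → sumFin f ≡ ∑ f
sumFin≡∑ {zero}  f = refl
sumFin≡∑ {suc n} f = cong (_+_ (f zero)) (sumFin≡∑ (λ k → f (suc k)))

∑-cong : ∀ {n} {f g : Fin n → ℤ} → (∀ k → f k ≡ g k) → ∑ f ≡ ∑ g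
∑-cong = sum-cong-≗

sum-zero : ∀ {n} (f : Fin n → ℤ) → (∀ k → f k ≡ 0ℤ) → ∑ f ≡ 0ℤ
sum-zero {n} f f≗0 = trans (∑-cong f≗0) (sum-replicate-zero n)

-- Negation and subtraction pass through finite sums (the library covers semirings only).
sum-neg : ∀ {n} (f : Fin n → ℤ) → ∑[ k < n ] (- f k) ≡ - ∑ f
sum-neg {zero}  f = refl
sum-neg {suc n} f =
  trans (cong (_+_ (- f zero)) (sum-neg (λ k → f (suc k)))) (sym (ℤP.neg-distrib-+ (f zero) _))

sum-minus : ∀ {n} (f g : Fin n → ℤ) → ∑[ k < n ] (f k + - g k) ≡ ∑ f + - ∑ g
sum-minus {n} f g = trans (∑-distrib-+ {n} f (λ k → - g k)) (cong (_+_ (∑ f)) (sum-neg g))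

drop-zero : ∀ {x} y → x ≡ 0ℤ → x + y ≡ y
drop-zero y refl = ℤP.+-identityˡ y

sift : ∀ {n} (g : ℕ → ℤ) a → a ℕ.< n → ∑[ k < n ] (g (toℕ k) * δ (toℕ k) a) ≡ g a
sift {suc n} g zero _ =
  trans (cong₂ _+_ (ℤP.*-identityʳ (g 0)) (sum-zero {n} _ (λ k → ℤP.*-zeroʳ (g (suc (toℕ k))))))
        (ℤP.+-identityʳ (g 0))
sift {suc n} g (suc a) (s≤s a<n) =
  trans (drop-zero _ (ℤP.*-zeroʳ (g 0))) (sift (λ m → g (suc m)) a a<n)

sift-out : ∀ {n} (g : ℕ → ℤ) a → n ℕ.≤ a → ∑[ k < n ] (g (toℕ k) * δ (toℕ k) a) ≡ 0ℤ
sift-out {zero}  g a       _         = refl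
sift-out {suc n} g (suc a) (s≤s n≤a) =
  trans (drop-zero _ (ℤP.*-zeroʳ (g 0))) (sift-out (λ m → g (suc m)) a n≤a)

sift-shift : ∀ {n} (g : ℕ → ℤ) a → a ℕ.≤ n → ∑[ k < n ] (g (toℕ k) * δ (suc (toℕ k)) a) ≡ prev g a
sift-shift {n} g zero    _   = sum-zero {n} _ (λ k → ℤP.*-zeroʳ (g (toℕ k)))
sift-shift {n} g (suc a) a<n = sift g a a<n

sift⁺ : ∀ {n} (g : ℕ → ℤ) a b → a ℕ.< n → b ℕ.< n
      → ∑[ k < n ] (g (toℕ k) * (δ (toℕ k) a + δ (toℕ k) b)) ≡ g a + g b
sift⁺ {n} g a b a<n b<n = begin
  ∑[ k < n ] (g (toℕ k) * (δ (toℕ k) a + δ (toℕ k) b))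
    ≡⟨ ∑-cong {n} (λ k → ℤP.*-distribˡ-+ (g (toℕ k)) (δ (toℕ k) a) (δ (toℕ k) b)) ⟩
  ∑[ k < n ] (g (toℕ k) * δ (toℕ k) a + g (toℕ k) * δ (toℕ k) b)
    ≡⟨ ∑-distrib-+ {n} (λ k → g (toℕ k) * δ (toℕ k) a) (λ k → g (toℕ k) * δ (toℕ k) b) ⟩
  ∑[ k < n ] (g (toℕ k) * δ (toℕ k) a) + ∑[ k < n ] (g (toℕ k) * δ (toℕ k) b)
    ≡⟨ cong₂ _+_ (sift g a a<n) (sift g b b<n) ⟩
  g a + g b ∎
  where open ≡-Reasoning

sift⁻ : ∀ {n} (g : ℕ → ℤ) a b → a ℕ.< n → b ℕ.< n
      → ∑[ k < n ] (g (toℕ k) * (δ (toℕ k) a + - δ (toℕ k) b)) ≡ g a + - g b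
sift⁻ {n} g a b a<n b<n = begin
  ∑[ k < n ] (g (toℕ k) * (δ (toℕ k) a + - δ (toℕ k) b))
    ≡⟨ ∑-cong {n} (λ k → distrib (g (toℕ k)) (δ (toℕ k) a) (δ (toℕ k) b)) ⟩
  ∑[ k < n ] (g (toℕ k) * δ (toℕ k) a + - (g (toℕ k) * δ (toℕ k) b))
    ≡⟨ sum-minus {n} (λ k → g (toℕ k) * δ (toℕ k) a) (λ k → g (toℕ k) * δ (toℕ k) b) ⟩
  ∑[ k < n ] (g (toℕ k) * δ (toℕ k) a) + - ∑[ k < n ] (g (toℕ k) * δ (toℕ k) b)
    ≡⟨ cong₂ (λ x y → x + - y) (sift g a a<n) (sift g b b<n) ⟩
  g a + - g b ∎
  where
  open ≡-Reasoning
  distrib : ∀ (x y z : ℤ) → x * (y + - z) ≡ x * y + - (x * z)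
  distrib = solve-∀

e-coord : ∀ {n} (i k : Fin n) → lookup (e i) k ≡ δ (toℕ k) (toℕ i)
e-coord i k =
  trans (lookup∘tabulate _ k) (cong (λ b → if b then 1ℤ else 0ℤ) (isYes≗does (toℕ k ℕ.≟ toℕ i)))

rootCoord : ∀ {n} → PosRoot n → ℕ → ℤ
rootCoord (diff i j _) m = δ m (toℕ i) + - δ m (toℕ j)
rootCoord (sum i j _)  m = δ m (toℕ i) + δ m (toℕ j)
rootCoord (long i)     m = δ m (toℕ i) + δ m (toℕ i)

corootCoord : ∀ {n} → PosRoot n → ℕ → ℤ
corootCoord (diff i j _) m = δ m (toℕ i) + - δ m (toℕ j)
corootCoord (sum i j _)  m = δ m (toℕ i) + δ m (toℕ j)
corootCoord (long i)     m = δ m (toℕ i)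

root-coord : ∀ {n} (γ : PosRoot n) (k : Fin n) → lookup (root γ) k ≡ rootCoord γ (toℕ k)
root-coord (diff i j _) k =
  trans (lookup∘tabulate _ k) (cong₂ (λ x y → x + - y) (e-coord i k) (e-coord j k))
root-coord (sum i j _)  k = trans (lookup∘tabulate _ k) (cong₂ _+_ (e-coord i k) (e-coord j k))
root-coord (long i)     k = trans (lookup∘tabulate _ k) (cong₂ _+_ (e-coord i k) (e-coord i k))

coroot-coord : ∀ {n} (γ : PosRoot n) (k : Fin n) → lookup (coroot γ) k ≡ corootCoord γ (toℕ k)
coroot-coord (diff i j _) k =
  trans (lookup∘tabulate _ k) (cong₂ (λ x y → x + - y) (e-coord i k) (e-coord j k))
coroot-coord (sum i j _)  k = trans (lookup∘tabulate _ k) (cong₂ _+_ (e-coord i k) (e-coord j k))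
coroot-coord (long i)     k = e-coord i k

pairing-coords : ∀ {n} (x y : Char n) (X Y : ℕ → ℤ)
  → (∀ k → lookup x k ≡ X (toℕ k)) → (∀ k → lookup y k ≡ Y (toℕ k))
  → ⟪ x , y ⟫ ≡ ∑[ k < n ] (X (toℕ k) * Y (toℕ k))
pairing-coords {n} x y X Y x≗X y≗Y =
  trans (sumFin≡∑ {n} _) (∑-cong {n} (λ k → cong₂ _*_ (x≗X k) (y≗Y k)))

evalCoroot : ∀ {n} → PosRoot n → (ℕ → ℤ) → ℤ
evalCoroot (diff i j _) x = x (toℕ i) + - x (toℕ j)
evalCoroot (sum i j _)  x = x (toℕ i) + x (toℕ j)
evalCoroot (long i)     x = x (toℕ i)

evalRoot : ∀ {n} → PosRoot n → (ℕ → ℤ) → ℤ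
evalRoot (diff i j _) y = y (toℕ i) + - y (toℕ j)
evalRoot (sum i j _)  y = y (toℕ i) + y (toℕ j)
evalRoot (long i)     y = y (toℕ i) + y (toℕ i)

against-coroot : ∀ {n} (γ : PosRoot n) (g : ℕ → ℤ)
  → ∑[ k < n ] (g (toℕ k) * corootCoord γ (toℕ k)) ≡ evalCoroot γ g
against-coroot (diff i j _) g = sift⁻ g (toℕ i) (toℕ j) (toℕ<n i) (toℕ<n j)
against-coroot (sum i j _)  g = sift⁺ g (toℕ i) (toℕ j) (toℕ<n i) (toℕ<n j)
against-coroot (long i)     g = sift g (toℕ i) (toℕ<n i)

against-root : ∀ {n} (γ : PosRoot n) (g : ℕ → ℤ)
  → ∑[ k < n ] (g (toℕ k) * rootCoord γ (toℕ k)) ≡ evalRoot γ g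
against-root (diff i j _) g = sift⁻ g (toℕ i) (toℕ j) (toℕ<n i) (toℕ<n j)
against-root (sum i j _)  g = sift⁺ g (toℕ i) (toℕ j) (toℕ<n i) (toℕ<n j)
against-root (long i)     g = sift⁺ g (toℕ i) (toℕ i) (toℕ<n i) (toℕ<n i)

pairing-eval : ∀ {n} (γ₂ γ₁ : PosRoot n) → pairing γ₂ γ₁ ≡ evalCoroot γ₁ (rootCoord γ₂)
pairing-eval γ₂ γ₁ =
  trans (pairing-coords (root γ₂) (coroot γ₁) (rootCoord γ₂) (corootCoord γ₁)
                        (root-coord γ₂) (coroot-coord γ₁))
        (against-coroot γ₁ (rootCoord γ₂))

-- ρ n m is the entry of 2ρ^∨ at (0-based) index m: (n - m) + (n - m - 1) = 2(n - m) - 1.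
ρ : ℕ → ℕ → ℤ
ρ n m = + (n ∸ m) + + (n ∸ suc m)

twoRho : ∀ {n} → Char n
twoRho {n} = tabulate (λ k → ρ n (toℕ k))

ρ-step : ∀ n k → suc k ℕ.< n → ρ n k + - ρ n (suc k) ≡ + 2
ρ-step (suc (suc n)) zero    _         = step (+ n)
  where
  step : ∀ x → (1ℤ + (1ℤ + x) + (1ℤ + x)) + - ((1ℤ + x) + x) ≡ + 2
  step = solve-∀
ρ-step (suc n)       (suc k) (s≤s k<n) = ρ-step n k k<n

ρ-last : ∀ {n κ} → κ ℕ.< n → κ ≡ n ∸ 1 → ρ n κ ≡ 1ℤ
ρ-last {suc n} _ refl = last n
  where
  last : ∀ n → ρ (suc n) n ≡ 1ℤ
  last zero    = refl
  last (suc n) = last n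

-- The entries are nonnegative and strictly decreasing; this is all that the
-- height comparisons use.
ρ-nonneg : ∀ n m → 0ℤ ≤ ρ n m
ρ-nonneg n m = +≤+ z≤n

ρ-decreasing : ∀ {n a b} → a ℕ.< b → b ℕ.< n → ρ n b < ρ n a
ρ-decreasing {n} a<b b<n =
  +<+ (ℕP.+-mono-<-≤ (ℕP.∸-monoʳ-< a<b (ℕP.<⇒≤ b<n)) (ℕP.∸-monoʳ-≤ n (s≤s (ℕP.<⇒≤ a<b))))

-- The coefficient of e_k in the k-th simple root: 2 for β = 2e_{n-1}, 1 otherwise.
lead : ℕ → ℕ → ℤ
lead N m = if m ≡ᵇ N then + 2 else 1ℤ

lead-last : ∀ {N m} → m ≡ N → lead N m ≡ + 2
lead-last m≡N = cong (λ b → if b then + 2 else 1ℤ) (≡ᵇ-true m≡N)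

lead-other : ∀ {N m} → m ≢ N → lead N m ≡ 1ℤ
lead-other m≢N = cong (λ b → if b then + 2 else 1ℤ) (≡ᵇ-false m≢N)

last-out : ∀ {n κ} → κ ℕ.< n → κ ≡ n ∸ 1 → n ℕ.≤ suc κ
last-out {suc n} _ refl = ℕP.≤-refl

past-last : ∀ {n κ ι} → κ ℕ.< n → κ ≡ n ∸ 1 → ι ℕ.< n → ι ≢ suc κ
past-last κ<n κ-last ι<n refl = ℕP.<⇒≱ ι<n (last-out κ<n κ-last)

n≢1+n : ∀ n → n ≢ suc n
n≢1+n n n≡1+n = ℕP.1+n≢n (sym n≡1+n)

not-last : ∀ {n κ} → κ ℕ.< n → κ ≢ n ∸ 1 → suc κ ℕ.< n
not-last {suc n} (s≤s κ≤n) κ≢n = s≤s (ℕP.≤∧≢⇒< κ≤n κ≢n)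

simple-entry : ∀ n κ ι → κ ℕ.< n → ι ℕ.< n
  → (if ⌊ κ ℕ.≟ (n ∸ 1) ⌋
     then (if ⌊ ι ℕ.≟ κ ⌋ then + 2 else 0ℤ)
     else (if ⌊ ι ℕ.≟ κ ⌋ then 1ℤ else if ⌊ ι ℕ.≟ suc κ ⌋ then - 1ℤ else 0ℤ))
    ≡ δ ι κ * lead (n ∸ 1) ι + - δ ι (suc κ)
simple-entry n κ ι κ<n ι<n
  rewrite isYes≗does (κ ℕ.≟ n ∸ 1) | isYes≗does (ι ℕ.≟ κ) | isYes≗does (ι ℕ.≟ suc κ)
  with ι ℕ.≟ κ
... | yes refl rewrite ≡ᵇ-true {ι} refl | ≡ᵇ-false (n≢1+n ι) with ι ≡ᵇ n ∸ 1
...   | true  = refl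
...   | false = refl
simple-entry n κ ι κ<n ι<n | no ι≢κ rewrite ≡ᵇ-false ι≢κ with κ ≡ᵇ n ∸ 1 in κ-last
...   | true rewrite ≡ᵇ-false (past-last κ<n (≡ᵇ-sound κ (n ∸ 1) κ-last) ι<n) = refl
...   | false with ι ≡ᵇ suc κ
...     | true  = refl
...     | false = refl

simple-coord : ∀ {n} (k j : Fin n)
  → lookup (simple k) j ≡ δ (toℕ j) (toℕ k) * lead (n ∸ 1) (toℕ j) + - δ (toℕ j) (suc (toℕ k))
simple-coord {n} k j = trans (lookup∘tabulate _ j) (simple-entry n (toℕ k) (toℕ j) (toℕ<n k) (toℕ<n j))

simple-against : ∀ {n} (k : Fin n) (y : Char n) (Y : ℕ → ℤ) → (∀ j → lookup y j ≡ Y (toℕ j))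
  → ⟪ simple k , y ⟫
    ≡ Y (toℕ k) * lead (n ∸ 1) (toℕ k) + - ∑[ j < n ] (Y (toℕ j) * δ (toℕ j) (suc (toℕ k)))
simple-against {n} k y Y y≗Y = begin
  ⟪ simple k , y ⟫
    ≡⟨ pairing-coords (simple k) y α Y (simple-coord k) y≗Y ⟩
  ∑[ j < n ] (α (toℕ j) * Y (toℕ j))
    ≡⟨ ∑-cong {n} (λ j → regroup (δ (toℕ j) κ) (lead N (toℕ j)) (δ (toℕ j) (suc κ)) (Y (toℕ j))) ⟩
  ∑[ j < n ] (here (toℕ j) + - next (toℕ j))
    ≡⟨ sum-minus {n} (λ j → here (toℕ j)) (λ j → next (toℕ j)) ⟩
  ∑[ j < n ] here (toℕ j) + - ∑[ j < n ] next (toℕ j)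
    ≡⟨ cong (_+ - ∑[ j < n ] next (toℕ j)) (sift (λ ι → Y ι * lead N ι) κ (toℕ<n k)) ⟩
  Y κ * lead N κ + - ∑[ j < n ] next (toℕ j) ∎
  where
  open ≡-Reasoning
  κ N : ℕ
  κ = toℕ k
  N = n ∸ 1
  α here next : ℕ → ℤ
  α ι = δ ι κ * lead N ι + - δ ι (suc κ)
  here ι = (Y ι * lead N ι) * δ ι κ
  next ι = Y ι * δ ι (suc κ)
  regroup : ∀ (d l d′ y : ℤ) → (d * l + - d′) * y ≡ (y * l) * d + - (y * d′)
  regroup = solve-∀

-- For y = 2ρ^∨ this value is 2: the last simple root gives ρ_{n-1} · 2 - 0 = 1 · 2, and
-- any other gives ρ_k - ρ_{k+1} = 2.
ρ-against-simple : ∀ n κ → κ ℕ.< n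
  → ρ n κ * lead (n ∸ 1) κ + - ∑[ j < n ] (ρ n (toℕ j) * δ (toℕ j) (suc κ)) ≡ + 2
ρ-against-simple n κ κ<n = evaluate (κ ℕ.≟ n ∸ 1)
  where
  open ≡-Reasoning
  N : ℕ
  N = n ∸ 1
  next : ℤ
  next = ∑[ j < n ] (ρ n (toℕ j) * δ (toℕ j) (suc κ))
  evaluate : Dec (κ ≡ N) → ρ n κ * lead N κ + - next ≡ + 2
  evaluate (yes κ-last) = begin
    ρ n κ * lead N κ + - next
      ≡⟨ cong₂ (λ r s → r * lead N κ + - s)
               (ρ-last κ<n κ-last) (sift-out (ρ n) (suc κ) (last-out κ<n κ-last)) ⟩
    1ℤ * lead N κ + - 0ℤ
      ≡⟨ cong (λ l → 1ℤ * l + - 0ℤ) (lead-last κ-last) ⟩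
    + 2 ∎
  evaluate (no κ-not-last) = begin
    ρ n κ * lead N κ + - next
      ≡⟨ cong₂ (λ l s → ρ n κ * l + - s)
               (lead-other κ-not-last) (sift (ρ n) (suc κ) (not-last κ<n κ-not-last)) ⟩
    ρ n κ * 1ℤ + - ρ n (suc κ)
      ≡⟨ cong (_+ - ρ n (suc κ)) (ℤP.*-identityʳ (ρ n κ)) ⟩
    ρ n κ + - ρ n (suc κ)
      ≡⟨ ρ-step n κ (not-last κ<n κ-not-last) ⟩
    + 2 ∎

simple-height : ∀ {n} (k : Fin n) → ⟪ simple k , twoRho ⟫ ≡ + 2
simple-height {n} k =
  trans (simple-against k twoRho (ρ n) (λ j → lookup∘tabulate _ j)) (ρ-against-simple n (toℕ k) (toℕ<n k))

pairing-lincomb : ∀ {n} (c : Fin n → ℤ) (y : Char n)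
  → ⟪ lincomb c , y ⟫ ≡ ∑[ k < n ] (c k * ⟪ simple k , y ⟫)
pairing-lincomb {n} c y = begin
  ⟪ lincomb c , y ⟫
    ≡⟨ sumFin≡∑ {n} _ ⟩
  ∑[ j < n ] (lookup (lincomb c) j * lookup y j)
    ≡⟨ ∑-cong {n} (λ j → cong (_* lookup y j) (trans (lookup∘tabulate _ j) (sumFin≡∑ {n} _))) ⟩
  ∑[ j < n ] (∑[ k < n ] (c k * lookup (simple k) j) * lookup y j)
    ≡⟨ ∑-cong {n} (λ j → *-distribʳ-sum (lookup y j) (λ k → c k * lookup (simple k) j)) ⟩
  ∑[ j < n ] ∑[ k < n ] (c k * lookup (simple k) j * lookup y j)
    ≡⟨ ∑-comm {n} {n} (λ j k → c k * lookup (simple k) j * lookup y j) ⟩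
  ∑[ k < n ] ∑[ j < n ] (c k * lookup (simple k) j * lookup y j)
    ≡⟨ ∑-cong {n} (λ k → factor k) ⟩
  ∑[ k < n ] (c k * ⟪ simple k , y ⟫) ∎
  where
  open ≡-Reasoning
  factor : ∀ k → ∑[ j < n ] (c k * lookup (simple k) j * lookup y j) ≡ c k * ⟪ simple k , y ⟫
  factor k = begin
    ∑[ j < n ] (c k * lookup (simple k) j * lookup y j)
      ≡⟨ ∑-cong {n} (λ j → ℤP.*-assoc (c k) (lookup (simple k) j) (lookup y j)) ⟩
    ∑[ j < n ] (c k * (lookup (simple k) j * lookup y j))
      ≡⟨ *-distribˡ-sum (c k) (λ j → lookup (simple k) j * lookup y j) ⟨
    c k * ∑[ j < n ] (lookup (simple k) j * lookup y j)
      ≡⟨ cong (c k *_) (sumFin≡∑ {n} _) ⟨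
    c k * ⟪ simple k , y ⟫ ∎

height-of-coeffs : ∀ {n} (x : Char n) (c : Fin n → ℤ) → IsCoeffs x c → ht c * + 2 ≡ ⟪ x , twoRho ⟫
height-of-coeffs {n} x c c-coeffs = begin
  ht c * + 2                              ≡⟨ cong (_* + 2) (sumFin≡∑ {n} c) ⟩
  ∑[ k < n ] c k * + 2                    ≡⟨ *-distribʳ-sum (+ 2) c ⟩
  ∑[ k < n ] (c k * + 2)                  ≡⟨ ∑-cong {n} (λ k → cong (c k *_) (simple-height k)) ⟨
  ∑[ k < n ] (c k * ⟪ simple k , twoRho ⟫) ≡⟨ pairing-lincomb c twoRho ⟨
  ⟪ lincomb c , twoRho ⟫                  ≡⟨ cong (λ v → ⟪ v , twoRho ⟫) c-coeffs ⟩
  ⟪ x , twoRho ⟫                          ∎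
  where open ≡-Reasoning

height-root : ∀ {n} (γ : PosRoot n) (c : Fin n → ℤ) → IsCoeffs (root γ) c → ht c * + 2 ≡ evalRoot γ (ρ n)
height-root {n} γ c c-coeffs = begin
  ht c * + 2
    ≡⟨ height-of-coeffs (root γ) c c-coeffs ⟩
  ⟪ root γ , twoRho ⟫
    ≡⟨ pairing-coords (root γ) twoRho (rootCoord γ) (ρ n) (root-coord γ) (λ k → lookup∘tabulate _ k) ⟩
  ∑[ k < n ] (rootCoord γ (toℕ k) * ρ n (toℕ k))
    ≡⟨ ∑-cong {n} (λ k → ℤP.*-comm (rootCoord γ (toℕ k)) (ρ n (toℕ k))) ⟩
  ∑[ k < n ] (ρ n (toℕ k) * rootCoord γ (toℕ k))
    ≡⟨ against-root γ (ρ n) ⟩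
  evalRoot γ (ρ n) ∎
  where open ≡-Reasoning

combination-coord : ∀ {n} (c : Fin n → ℤ) (A : ℕ → ℤ) → (∀ k → c k ≡ A (toℕ k)) → (j : Fin n)
  → sumFin (λ k → c k * lookup (simple k) j) ≡ A (toℕ j) * lead (n ∸ 1) (toℕ j) + - prev A (toℕ j)
combination-coord {n} c A c≗A j = begin
  sumFin (λ k → c k * lookup (simple k) j)
    ≡⟨ sumFin≡∑ {n} _ ⟩
  ∑[ k < n ] (c k * lookup (simple k) j)
    ≡⟨ ∑-cong {n} (λ k → cong₂ _*_ (c≗A k) (simple-coord′ k)) ⟩
  ∑[ k < n ] (A (toℕ k) * (δ (toℕ k) ι * lead N ι + - δ (suc (toℕ k)) ι))
    ≡⟨ ∑-cong {n} (λ k → regroup (A (toℕ k)) (δ (toℕ k) ι) (lead N ι) (δ (suc (toℕ k)) ι)) ⟩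
  ∑[ k < n ] (here (toℕ k) + - before (toℕ k))
    ≡⟨ sum-minus {n} (λ k → here (toℕ k)) (λ k → before (toℕ k)) ⟩
  ∑[ k < n ] here (toℕ k) + - ∑[ k < n ] before (toℕ k)
    ≡⟨ cong₂ (λ p q → p + - q) (sift (λ m → A m * lead N ι) ι ι<n) (sift-shift A ι (ℕP.<⇒≤ ι<n)) ⟩
  A ι * lead N ι + - prev A ι ∎
  where
  open ≡-Reasoning
  ι N : ℕ
  ι = toℕ j
  N = n ∸ 1
  ι<n : ι ℕ.< n
  ι<n = toℕ<n j
  here before : ℕ → ℤ
  here m = (A m * lead N ι) * δ m ι
  before m = A m * δ (suc m) ι
  simple-coord′ : ∀ k → lookup (simple k) j ≡ δ (toℕ k) ι * lead N ι + - δ (suc (toℕ k)) ι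
  simple-coord′ k = trans (simple-coord k j)
    (cong₂ (λ d d′ → d * lead N ι + - d′) (δ-sym ι (toℕ k)) (δ-sym ι (suc (toℕ k))))
  regroup : ∀ (a d l d′ : ℤ) → a * (d * l + - d′) ≡ (a * l) * d + - (a * d′)
  regroup = solve-∀

-- Coefficients of e_a + e_b (a ≤ b ≤ N = n - 1) in the basis of simple roots:
-- 0 below a, 1 from a to b - 1, 2 from b to N - 1, and 1 at the long simple root N.
pairCoeffs : ℕ → ℕ → ℕ → ℕ → ℤ
pairCoeffs a b N m = if m ≡ᵇ N then 1ℤ else if b ≤ᵇ m then + 2 else if a ≤ᵇ m then 1ℤ else 0ℤ

pairCoeffs-below : ∀ {a b N m} → a ℕ.≤ b → m ℕ.< N → pairCoeffs a b N m ≡ θ a m + θ b m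
pairCoeffs-below {a} {b} {N} {m} a≤b m<N rewrite ≡ᵇ-false (ℕP.<⇒≢ m<N) with b ≤ᵇ m in b≤m
... | true rewrite ≤ᵇ-true (ℕP.≤-trans a≤b (≤ᵇ-sound b≤m)) = refl
... | false with a ≤ᵇ m
...   | true  = refl
...   | false = refl

-- … and at N, where the long simple root 2e_N enters with coefficient 1, rescaling
-- by lead N = 2 restores the same pattern.
pairCoeffs-scaled : ∀ {a b N m} → a ℕ.≤ b → b ℕ.≤ N → m ℕ.≤ N
  → pairCoeffs a b N m * lead N m ≡ θ a m + θ b m
pairCoeffs-scaled {a} {b} {N} {m} a≤b b≤N m≤N with m ℕ.≟ N
... | yes refl rewrite ≡ᵇ-true {m} refl | ≤ᵇ-true (ℕP.≤-trans a≤b b≤N) | ≤ᵇ-true b≤N = refl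
... | no m≢N =
  trans (cong (pairCoeffs a b N m *_) (lead-other m≢N))
        (trans (ℤP.*-identityʳ _) (pairCoeffs-below a≤b (ℕP.≤∧≢⇒< m≤N m≢N)))

-- Shifting by one index stays below N, so the previous coefficient is a sum of steps too.
pairCoeffs-prev : ∀ {a b N m} → a ℕ.≤ b → m ℕ.≤ N
  → prev (pairCoeffs a b N) m ≡ prev (θ a) m + prev (θ b) m
pairCoeffs-prev {m = zero}  _   _          = refl
pairCoeffs-prev {m = suc m} a≤b 1+m≤N = pairCoeffs-below a≤b 1+m≤N

pairCoeffs-coord : ∀ {a b N m} → a ℕ.≤ b → b ℕ.≤ N → m ℕ.≤ N
  → pairCoeffs a b N m * lead N m + - prev (pairCoeffs a b N) m ≡ δ m a + δ m b
pairCoeffs-coord {a} {b} {N} {m} a≤b b≤N m≤N = begin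
  pairCoeffs a b N m * lead N m + - prev (pairCoeffs a b N) m
    ≡⟨ cong₂ (λ p q → p + - q) (pairCoeffs-scaled a≤b b≤N m≤N) (pairCoeffs-prev a≤b m≤N) ⟩
  (θ a m + θ b m) + - (prev (θ a) m + prev (θ b) m)
    ≡⟨ regroup (θ a m) (θ b m) (prev (θ a) m) (prev (θ b) m) ⟩
  (θ a m + - prev (θ a) m) + (θ b m + - prev (θ b) m)
    ≡⟨ cong₂ _+_ (θ-derivative a m) (θ-derivative b m) ⟩
  δ m a + δ m b ∎
  where
  open ≡-Reasoning
  regroup : ∀ (x y x′ y′ : ℤ) → (x + y) + - (x′ + y′) ≡ (x + - x′) + (y + - y′)
  regroup = solve-∀

<⇒≤∸1 : ∀ {m n} → m ℕ.< n → m ℕ.≤ n ∸ 1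
<⇒≤∸1 (s≤s m≤n) = m≤n

pairCoeffs-correct : ∀ {n} (i j : Fin n) (c : Fin n → ℤ) → toℕ i ℕ.≤ toℕ j
  → (∀ k → c k ≡ pairCoeffs (toℕ i) (toℕ j) (n ∸ 1) (toℕ k)) → IsCoeffs (e i ⊕ e j) c
pairCoeffs-correct {n} i j c i≤j c≗P = tabulate-cong λ k → begin
  sumFin (λ l → c l * lookup (simple l) k)
    ≡⟨ combination-coord c P c≗P k ⟩
  P (toℕ k) * lead N (toℕ k) + - prev P (toℕ k)
    ≡⟨ pairCoeffs-coord i≤j (<⇒≤∸1 (toℕ<n j)) (<⇒≤∸1 (toℕ<n k)) ⟩
  δ (toℕ k) (toℕ i) + δ (toℕ k) (toℕ j)
    ≡⟨ cong₂ _+_ (e-coord i k) (e-coord j k) ⟨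
  lookup (e i) k + lookup (e j) k ∎
  where
  open ≡-Reasoning
  N : ℕ
  N = n ∸ 1
  P : ℕ → ℤ
  P = pairCoeffs (toℕ i) (toℕ j) N

coeffs₁-pairCoeffs : ∀ {n} (i j k : Fin n) → coeffs₁ i j k ≡ pairCoeffs (toℕ i) (toℕ j) (n ∸ 1) (toℕ k)
coeffs₁-pairCoeffs {n} i j k
  rewrite isYes≗does (toℕ k ℕ.≟ n ∸ 1) | isYes≗does (toℕ j ℕ.≤? toℕ k)
        | isYes≗does (toℕ i ℕ.≤? toℕ k) = refl

coeffs₂-pairCoeffs : ∀ {n} (i k : Fin n) → coeffs₂ i k ≡ pairCoeffs (toℕ i) (toℕ i) (n ∸ 1) (toℕ k)
coeffs₂-pairCoeffs {n} i k
  rewrite isYes≗does (toℕ k ℕ.≟ n ∸ 1) | isYes≗does (toℕ i ℕ.≤? toℕ k) with toℕ k ≡ᵇ n ∸ 1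
... | true  = refl
... | false with toℕ i ≤ᵇ toℕ k
...   | true  = refl
...   | false = refl

coeffs₁-correct : ∀ {n} (i j : Fin n) → toℕ i ℕ.≤ toℕ j → IsCoeffs (e i ⊕ e j) (coeffs₁ i j)
coeffs₁-correct i j i≤j = pairCoeffs-correct i j (coeffs₁ i j) i≤j (coeffs₁-pairCoeffs i j)

coeffs₂-correct : ∀ {n} (i : Fin n) → IsCoeffs (e i ⊕ e i) (coeffs₂ i)
coeffs₂-correct i = pairCoeffs-correct i i (coeffs₂ i) ℕP.≤-refl (coeffs₂-pairCoeffs i)

-- Which pairs of positive roots have ⟨γ₂, γ₁^∨⟩ = 2.  Each lemma below is a finite
-- check on the coincidences among the indices of γ₁ and γ₂; they are named
-- pair-⟨shape of γ₁⟩-⟨shape of γ₂⟩ and state what the value 2 forces.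

pair-long-long : ∀ a c → δ a c + δ a c ≡ + 2 → a ≡ c
pair-long-long a c with a ≡ᵇ c in ac
... | true  = λ _ → ≡ᵇ-sound a c ac
... | false = λ ()

pair-diff-long : ∀ a b c → (δ a c + δ a c) + - (δ b c + δ b c) ≡ + 2 → a ≡ c
pair-diff-long a b c with a ≡ᵇ c in ac | b ≡ᵇ c
... | true  | true  = λ ()
... | true  | false = λ _ → ≡ᵇ-sound a c ac
... | false | true  = λ ()
... | false | false = λ ()

pair-sum-long : ∀ a b c → (δ a c + δ a c) + (δ b c + δ b c) ≡ + 2 → a ≡ c ⊎ b ≡ c
pair-sum-long a b c with a ≡ᵇ c in ac | b ≡ᵇ c in bc
... | true  | true  = λ ()
... | true  | false = λ _ → inj₁ (≡ᵇ-sound a c ac)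
... | false | true  = λ _ → inj₂ (≡ᵇ-sound b c bc)
... | false | false = λ ()

pair-long-diff : ∀ a c d → ¬ (δ a c + - δ a d ≡ + 2)
pair-long-diff a c d with a ≡ᵇ c | a ≡ᵇ d
... | true  | true  = λ ()
... | true  | false = λ ()
... | false | true  = λ ()
... | false | false = λ ()

pair-long-sum : ∀ a c d → δ a c + δ a d ≡ + 2 → c ≡ d
pair-long-sum a c d with a ≡ᵇ c in ac | a ≡ᵇ d in ad
... | true  | true  = λ _ → trans (sym (≡ᵇ-sound a c ac)) (≡ᵇ-sound a d ad)
... | true  | false = λ ()
... | false | true  = λ ()
... | false | false = λ ()

pair-diff-diff : ∀ a b c d → (δ a c + - δ a d) + - (δ b c + - δ b d) ≡ + 2 → a ≡ c × b ≡ d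
pair-diff-diff a b c d with a ≡ᵇ c in ac | a ≡ᵇ d | b ≡ᵇ c | b ≡ᵇ d in bd
... | true  | true  | true  | true  = λ ()
... | true  | true  | true  | false = λ ()
... | true  | true  | false | true  = λ ()
... | true  | true  | false | false = λ ()
... | true  | false | true  | true  = λ ()
... | true  | false | true  | false = λ ()
... | true  | false | false | true  = λ _ → ≡ᵇ-sound a c ac , ≡ᵇ-sound b d bd
... | true  | false | false | false = λ ()
... | false | true  | true  | true  = λ ()
... | false | true  | true  | false = λ ()
... | false | true  | false | true  = λ ()
... | false | true  | false | false = λ ()
... | false | false | true  | true  = λ ()
... | false | false | true  | false = λ ()
... | false | false | false | true  = λ ()
... | false | false | false | false = λ ()

pair-sum-diff : ∀ a b c d → (δ a c + - δ a d) + (δ b c + - δ b d) ≡ + 2 → a ≡ b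
pair-sum-diff a b c d with a ≡ᵇ c in ac | a ≡ᵇ d | b ≡ᵇ c in bc | b ≡ᵇ d
... | true  | true  | true  | true  = λ ()
... | true  | true  | true  | false = λ ()
... | true  | true  | false | true  = λ ()
... | true  | true  | false | false = λ ()
... | true  | false | true  | true  = λ ()
... | true  | false | true  | false = λ _ → trans (≡ᵇ-sound a c ac) (sym (≡ᵇ-sound b c bc))
... | true  | false | false | true  = λ ()
... | true  | false | false | false = λ ()
... | false | true  | true  | true  = λ ()
... | false | true  | true  | false = λ ()
... | false | true  | false | true  = λ ()
... | false | true  | false | false = λ ()
... | false | false | true  | true  = λ ()
... | false | false | true  | false = λ ()
... | false | false | false | true  = λ ()
... | false | false | false | false = λ ()

pair-diff-sum : ∀ a b c d → (δ a c + δ a d) + - (δ b c + δ b d) ≡ + 2 → c ≡ d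
pair-diff-sum a b c d with a ≡ᵇ c in ac | a ≡ᵇ d in ad | b ≡ᵇ c | b ≡ᵇ d
... | true  | true  | true  | true  = λ ()
... | true  | true  | true  | false = λ ()
... | true  | true  | false | true  = λ ()
... | true  | true  | false | false = λ _ → trans (sym (≡ᵇ-sound a c ac)) (≡ᵇ-sound a d ad)
... | true  | false | true  | true  = λ ()
... | true  | false | true  | false = λ ()
... | true  | false | false | true  = λ ()
... | true  | false | false | false = λ ()
... | false | true  | true  | true  = λ ()
... | false | true  | true  | false = λ ()
... | false | true  | false | true  = λ ()
... | false | true  | false | false = λ ()
... | false | false | true  | true  = λ ()
... | false | false | true  | false = λ ()
... | false | false | false | true  = λ ()
... | false | false | false | false = λ ()

pair-sum-sum : ∀ a b c d → a ℕ.< b → c ℕ.< d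
  → (δ a c + δ a d) + (δ b c + δ b d) ≡ + 2 → a ≡ c × b ≡ d
pair-sum-sum a b c d a<b c<d with a ≡ᵇ c in ac | a ≡ᵇ d in ad | b ≡ᵇ c in bc | b ≡ᵇ d in bd
... | true  | true  | true  | true  = λ ()
... | true  | true  | true  | false = λ ()
... | true  | true  | false | true  = λ ()
... | true  | true  | false | false =
  λ _ → ⊥-elim (ℕP.<-irrefl (trans (sym (≡ᵇ-sound a c ac)) (≡ᵇ-sound a d ad)) c<d)
... | true  | false | true  | true  = λ ()
... | true  | false | true  | false =
  λ _ → ⊥-elim (ℕP.<-irrefl (trans (≡ᵇ-sound a c ac) (sym (≡ᵇ-sound b c bc))) a<b)
... | true  | false | false | true  = λ _ → ≡ᵇ-sound a c ac , ≡ᵇ-sound b d bd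
... | true  | false | false | false = λ ()
... | false | true  | true  | true  = λ ()
... | false | true  | true  | false =
  λ _ → ⊥-elim (ℕP.<-asym a<b (subst₂ ℕ._<_ (sym (≡ᵇ-sound b c bc)) (sym (≡ᵇ-sound a d ad)) c<d))
... | false | true  | false | true  =
  λ _ → ⊥-elim (ℕP.<-irrefl (trans (≡ᵇ-sound a d ad) (sym (≡ᵇ-sound b d bd))) a<b)
... | false | true  | false | false = λ ()
... | false | false | true  | true  =
  λ _ → ⊥-elim (ℕP.<-irrefl (trans (sym (≡ᵇ-sound b c bc)) (≡ᵇ-sound b d bd)) c<d)
... | false | false | true  | false = λ ()
... | false | false | false | true  = λ ()
... | false | false | false | false = λ ()

data PairsToTwo {n} : PosRoot n → PosRoot n → Set where
  diff-long  : ∀ {a b} (a<b : toℕ a ℕ.< toℕ b) → PairsToTwo (diff a b a<b) (long a)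
  sum-longˡ  : ∀ {a b} (a<b : toℕ a ℕ.< toℕ b) → PairsToTwo (sum a b a<b) (long a)
  sum-longʳ  : ∀ {a b} (a<b : toℕ a ℕ.< toℕ b) → PairsToTwo (sum a b a<b) (long b)

classify : ∀ {n} (γ₁ γ₂ : PosRoot n) → root γ₁ ≢ root γ₂
  → evalCoroot γ₁ (rootCoord γ₂) ≡ + 2 → PairsToTwo γ₁ γ₂
classify (long a) (long c) γ₁≢γ₂ two =
  ⊥-elim (γ₁≢γ₂ (cong (λ x → e x ⊕ e x) (toℕ-injective (pair-long-long _ _ two))))
classify (diff a b a<b) (long c) _ two
  with toℕ-injective (pair-diff-long (toℕ a) (toℕ b) (toℕ c) two)
... | refl = diff-long a<b
classify (sum a b a<b) (long c) _ two with pair-sum-long (toℕ a) (toℕ b) (toℕ c) two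
... | inj₁ a≡c with toℕ-injective a≡c
...   | refl = sum-longˡ a<b
classify (sum a b a<b) (long c) _ two | inj₂ b≡c with toℕ-injective b≡c
...   | refl = sum-longʳ a<b
classify (long a) (diff c d _) _ two = ⊥-elim (pair-long-diff (toℕ a) (toℕ c) (toℕ d) two)
classify (diff a b _) (diff c d _) γ₁≢γ₂ two
  with pair-diff-diff (toℕ a) (toℕ b) (toℕ c) (toℕ d) two
... | a≡c , b≡d =
  ⊥-elim (γ₁≢γ₂ (cong₂ (λ x y → e x ⊖ e y) (toℕ-injective a≡c) (toℕ-injective b≡d)))
classify (sum a b a<b) (diff c d _) _ two =
  ⊥-elim (ℕP.<-irrefl (pair-sum-diff (toℕ a) (toℕ b) (toℕ c) (toℕ d) two) a<b)
classify (long a) (sum c d c<d) _ two =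
  ⊥-elim (ℕP.<-irrefl (pair-long-sum (toℕ a) (toℕ c) (toℕ d) two) c<d)
classify (diff a b _) (sum c d c<d) _ two =
  ⊥-elim (ℕP.<-irrefl (pair-diff-sum (toℕ a) (toℕ b) (toℕ c) (toℕ d) two) c<d)
classify (sum a b a<b) (sum c d c<d) γ₁≢γ₂ two
  with pair-sum-sum (toℕ a) (toℕ b) (toℕ c) (toℕ d) a<b c<d two
... | a≡c , b≡d =
  ⊥-elim (γ₁≢γ₂ (cong₂ (λ x y → e x ⊕ e y) (toℕ-injective a≡c) (toℕ-injective b≡d)))

no-room-above : ∀ {h₁ h₂ x y : ℤ} → 0ℤ ≤ y → h₁ * + 2 ≡ x + - y → h₂ * + 2 ≡ x + x → ¬ (h₂ < + 2 * h₁)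
no-room-above {h₁} {h₂} {x} {y} 0≤y h₁-eq h₂-eq h₂<2h₁ =
  ℤP.<⇒≱ (ℤP.*-monoʳ-<-pos (+ 2) h₂<2h₁) twice-below
  where
  open ℤP.≤-Reasoning
  double : ∀ h → (+ 2 * h) * + 2 ≡ h * + 2 + h * + 2
  double = solve-∀
  x-y≤x : x + - y ≤ x
  x-y≤x = begin
    x + - y   ≤⟨ ℤP.+-monoʳ-≤ x (ℤP.neg-mono-≤ 0≤y) ⟩
    x + 0ℤ    ≡⟨ ℤP.+-identityʳ x ⟩
    x         ∎
  twice-below : (+ 2 * h₁) * + 2 ≤ h₂ * + 2
  twice-below = begin
    (+ 2 * h₁) * + 2            ≡⟨ double h₁ ⟩
    h₁ * + 2 + h₁ * + 2         ≡⟨ cong₂ _+_ h₁-eq h₁-eq ⟩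
    (x + - y) + (x + - y)       ≤⟨ ℤP.+-mono-≤ x-y≤x x-y≤x ⟩
    x + x                       ≡⟨ h₂-eq ⟨
    h₂ * + 2                    ∎

no-room-below : ∀ {h₁ h₂ x y : ℤ} → y < x → h₁ * + 2 ≡ x + y → h₂ * + 2 ≡ y + y → ¬ (h₁ ≤ h₂)
no-room-below {h₁} {h₂} {x} {y} y<x h₁-eq h₂-eq h₁≤h₂ =
  ℤP.<⇒≱ (ℤP.+-monoˡ-< y y<x) (subst₂ _≤_ h₁-eq h₂-eq (ℤP.*-monoʳ-≤-nonNeg (+ 2) h₁≤h₂))

lemma3p1 : (n : ℕ) → 1 ℕ.< n → (γ₁ γ₂ : PosRoot n) → root γ₁ ≢ root γ₂
    → (c₁ c₂ : Fin n → ℤ) → IsCoeffs (root γ₁) c₁ → IsCoeffs (root γ₂) c₂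
    → ht c₂ < + 2 * ht c₁ → ht c₁ ≤ ht c₂
    → pairing γ₂ γ₁ ≡ + 2
    → ∃₂ λ (i j : Fin n) → toℕ i ℕ.< toℕ j
        × IsCoeffs (root γ₂) (coeffs₂ i) × IsCoeffs (root γ₁) (coeffs₁ i j)
lemma3p1 n _ γ₁ γ₂ γ₁≢γ₂ c₁ c₂ c₁-coeffs c₂-coeffs ht₂<2ht₁ ht₁≤ht₂ pairing≡2
  with classify γ₁ γ₂ γ₁≢γ₂ (trans (sym (pairing-eval γ₂ γ₁)) pairing≡2)
... | diff-long {a} {b} _ = ⊥-elim (no-room-above {x = ρ n (toℕ a)} (ρ-nonneg n (toℕ b))
        (height-root γ₁ c₁ c₁-coeffs) (height-root γ₂ c₂ c₂-coeffs) ht₂<2ht₁)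
... | sum-longˡ {a} {b} a<b = a , b , a<b , coeffs₂-correct a , coeffs₁-correct a b (ℕP.<⇒≤ a<b)
... | sum-longʳ {a} {b} a<b = ⊥-elim (no-room-below {x = ρ n (toℕ a)} (ρ-decreasing a<b (toℕ<n b))
        (height-root γ₁ c₁ c₁-coeffs) (height-root γ₂ c₂ c₂-coeffs) ht₁≤ht₂)
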